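{- Let $G$ be a connected graph with $n(G)\ge 3$ and let $x$ be a leaf (vertex of degree $1$) of $G$. Then $v_x(G)<\mathrm{vv}(G)$.
   Context: All graphs are finite and simple; $n(G)$ denotes the number of vertices of $G$. For a vertex $x$ of a connected graph $G$, a set $S\subseteq V(G)\setminus\{x\}$ is an $x$-visibility set if for every $y\in S$ there exists a shortest $x,y$-path $P$ in $G$ with $V(P)\cap S=\{y\}$. The $x$-visibility number $v_x(G)$ is the maximum cardinality of an $x$-visibility set, and the vertex visibility number is $\mathrm{vv}(G)=\max_{x\in V(G)} v_x(G)$. -}

module Defs where

open import Data.Nat using (ℕ; zero; suc; _≤_; _<_)
open import Data.Fin using (Fin)
open import Data.Fin.Subset using (Subset; _∈_; _∉_; ∣_∣)
open import Data.List using (List; []; _∷_)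
open import Data.List.Relation.Unary.All using (All)
open import Data.Product using (Σ; ∃; ∃-syntax; _×_; _,_)
open import Relation.Binary.PropositionalEquality using (_≡_)
open import Relation.Nullary using (¬_)

record Graph (n : ℕ) : Set₁ where
  field
    Adj   : Fin n → Fin n → Set
    sym   : ∀ {u v} → Adj u v → Adj v u
    irrefl : ∀ {u} → ¬ Adj u u
open Graph public

module _ {n : ℕ} (G : Graph n) where

  data Walk : Fin n → Fin n → Set where
    [] : ∀ {x} → Walk x x
    _∷_ : ∀ {x z y} → Adj G x z → Walk z y → Walk x y

  len : ∀ {x y} → Walk x y → ℕ
  len [] = 0
  len (_ ∷ w) = suc (len w)

  verts : ∀ {x y} → Walk x y → List (Fin n)
  verts {x} [] = x ∷ []
  verts {x} (_ ∷ w) = x ∷ verts w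

  -- A shortest x,y-walk (necessarily a path): no x,y-walk is shorter.
  IsShortest : ∀ {x y} → Walk x y → Set
  IsShortest {x} {y} p = ∀ (q : Walk x y) → len p ≤ len q

  Connected : Set
  Connected = ∀ (u v : Fin n) → Walk u v

  IsLeaf : Fin n → Set
  IsLeaf x = Σ (Fin n) λ u → Adj G x u × (∀ w → Adj G x w → w ≡ u)

  IsVisibilitySet : Fin n → Subset n → Set
  IsVisibilitySet x S =
    x ∉ S ×
    (∀ y → y ∈ S →
      Σ (Walk x y) λ P → IsShortest P ×
        All (λ z → z ∈ S → z ≡ y) (verts P))

  IsVisNumber : Fin n → ℕ → Set
  IsVisNumber x k =
    (Σ (Subset n) λ S → IsVisibilitySet x S × ∣ S ∣ ≡ k) ×
    (∀ S → IsVisibilitySet x S → ∣ S ∣ ≤ k)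

  IsVertexVisNumber : ℕ → Set
  IsVertexVisNumber m =
    (Σ (Fin n) λ y → IsVisNumber y m) ×
    (∀ y k → IsVisNumber y k → k ≤ m)

-- Let u be the unique neighbour of the leaf x and S a maximum x-visibility set. Every shortest
-- path from x is the edge xu followed by a shortest u-path that avoids x, so if u ∉ S then
-- S ∪ {x} is a u-visibility set. If u ∈ S, then u hides every other vertex of S from x, so
-- S ⊆ {u}; but {w, x} is a u-visibility set for any second neighbour w of u, which exists since
-- G is connected with at least three vertices. Either way v_u(G) > |S| = v_x(G).
module Submission where

open import Defs
open import Data.Nat using (ℕ; zero; suc; _≤_; _<_; z≤n; s≤s; z<s; _≤?_)
open import Data.Nat.Properties using (≤-antisym; ≤-trans; <-≤-trans; m≤n⇒m≤1+n; ≤-refl; ≤-pred; ≰⇒>; <⇒≱; module ≤-Reasoning)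
open import Data.Fin using (Fin; _≟_) renaming (zero to fzero; suc to fsuc)
open import Data.Fin.Subset using (Subset; _∈_; _∉_; ∣_∣; _∪_; ⁅_⁆; _⊆_)
open import Data.Fin.Subset.Properties using (_∈?_; x∈p∪q⁻; x∈p∪q⁺; x∈⁅x⁆; x∈⁅y⁆⇒x≡y; p⊆p∪q; p⊂q⇒∣p∣<∣q∣; p⊆q⇒∣p∣≤∣q∣; ∣⁅x⁆∣≡1; ∣p∣≤n)
open import Data.List.Relation.Unary.All as All using (All; []; _∷_)
open import Data.Product using (Σ; ∃; _×_; _,_; proj₁)
open import Data.Sum using (inj₁; inj₂; [_,_]′)
open import Data.Empty using (⊥)
open import Function using (_∘_)
open import Relation.Nullary using (¬_; yes; no; contradiction)
open import Relation.Nullary.Decidable using (decidable-stable; ¬¬-excluded-middle)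
open import Relation.Nullary.Negation using (¬¬-map)
open import Relation.Binary.PropositionalEquality using (_≡_; _≢_; refl; subst; ≢-sym)

¬¬-maximum : ∀ {a} {A : Set a} (P : A → Set) (f : A → ℕ) (b : ℕ) →
  (∀ z → P z → f z ≤ b) → Σ A P →
  ¬ ¬ (Σ ℕ λ k → (Σ A λ z → P z × f z ≡ k) × (∀ z → P z → f z ≤ k))
¬¬-maximum {A = A} P f b bound (z₀ , pz₀) ¬max =
  ¬¬-excluded-middle {A = Σ A λ z → P z × b ≤ f z} λ where
    (yes (z , pz , b≤fz)) → ¬max (b , (z , pz , ≤-antisym (bound z pz) b≤fz) , bound)
    (no unattained) → lower b unattained
  where
  lower : ∀ b → ¬ (Σ A λ z → P z × b ≤ f z) → ⊥
  lower zero    unattained = unattained (z₀ , pz₀ , z≤n)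
  lower (suc b) unattained =
    ¬¬-maximum P f b (λ z pz → ≤-pred (≰⇒> (λ b<fz → unattained (z , pz , b<fz)))) (z₀ , pz₀) ¬max

∣p∣<∣p∪⁅x⁆∣ : ∀ {n} {p : Subset n} {x} → x ∉ p → ∣ p ∣ < ∣ p ∪ ⁅ x ⁆ ∣
∣p∣<∣p∪⁅x⁆∣ {x = x} x∉p = p⊂q⇒∣p∣<∣q∣ (p⊆p∪q ⁅ x ⁆ , x , x∈p∪q⁺ (inj₂ (x∈⁅x⁆ x)) , x∉p)

third-vertex : ∀ {n} → 3 ≤ n → (a b : Fin n) → ∃ λ c → c ≢ a × c ≢ b
third-vertex {suc zero} (s≤s ())
third-vertex {suc (suc zero)} (s≤s (s≤s ()))
third-vertex {suc (suc (suc _))} _ a b with fzero ≟ a | fzero ≟ b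
... | no 0≢a | no 0≢b = fzero , 0≢a , 0≢b
... | yes refl | _ with fsuc fzero ≟ b
...   | no 1≢b = fsuc fzero , (λ ()) , 1≢b
...   | yes refl = fsuc (fsuc fzero) , (λ ()) , (λ ())
third-vertex {suc (suc (suc _))} _ a b | no _ | yes refl with fsuc fzero ≟ a
...   | no 1≢a = fsuc fzero , 1≢a , (λ ())
...   | yes refl = fsuc (fsuc fzero) , (λ ()) , (λ ())

module _ {n : ℕ} (G : Graph n) where

  VisibleFrom : Fin n → Subset n → Fin n → Set
  VisibleFrom x S y = Σ (Walk G x y) λ P → IsShortest G P × All (λ z → z ∈ S → z ≡ y) (verts G P)

  0<len : ∀ {a b} → a ≢ b → (P : Walk G a b) → 0 < len G P
  0<len a≢b []      = contradiction refl a≢b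
  0<len _   (_ ∷ _) = z<s

  All-verts⇒source : ∀ {Q : Fin n → Set} {a b} (P : Walk G a b) → All Q (verts G P) → Q a
  All-verts⇒source []      (qa ∷ _) = qa
  All-verts⇒source (_ ∷ _) (qa ∷ _) = qa

  suffixes-not-longer : ∀ {a b} (P : Walk G a b) →
    All (λ z → Σ (Walk G z b) λ Q → len G Q ≤ len G P) (verts G P)
  suffixes-not-longer []      = ([] , z≤n) ∷ []
  suffixes-not-longer (e ∷ P) =
    (e ∷ P , ≤-refl) ∷ All.map (λ (Q , Q≤P) → Q , m≤n⇒m≤1+n Q≤P) (suffixes-not-longer P)

  shortest-tail : ∀ {a c b} {e : Adj G a c} {P : Walk G c b} → IsShortest G (e ∷ P) → IsShortest G P
  shortest-tail {e = e} shortest Q = ≤-pred (shortest (e ∷ Q))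

  shortest-tail-avoids-source : ∀ {a c b} {e : Adj G a c} {P : Walk G c b} →
    IsShortest G (e ∷ P) → All (_≢ a) (verts G P)
  shortest-tail-avoids-source {P = P} shortest = All.map avoids (suffixes-not-longer P)
    where
    avoids : ∀ {z} → Σ (Walk G z _) (λ Q → len G Q ≤ len G P) → z ≢ _
    avoids (Q , Q≤P) refl = <⇒≱ (s≤s Q≤P) (shortest Q)

  edge-visible : ∀ {u y S} → u ∉ S → Adj G u y → VisibleFrom u S y
  edge-visible u∉S e =
    e ∷ [] , 0<len (λ { refl → irrefl G e }) , (λ u∈S → contradiction u∈S u∉S) ∷ (λ _ → refl) ∷ []

  neighbours-visibilitySet : ∀ {u S} → (∀ {y} → y ∈ S → Adj G u y) → IsVisibilitySet G u S
  neighbours-visibilitySet adj = u∉S , λ _ y∈S → edge-visible u∉S (adj y∈S)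
    where u∉S = λ u∈S → irrefl G (adj u∈S)

  ¬¬-visNumber : ∀ {x S} → IsVisibilitySet G x S → ¬ ¬ ∃ (IsVisNumber G x)
  ¬¬-visNumber {S = S} vis = ¬¬-maximum (IsVisibilitySet G _) ∣_∣ n (λ T _ → ∣p∣≤n T) (S , vis)

  -- Maxima of visibility sets exist only up to double negation, which ≤ on ℕ is stable under.
  visibilitySet≤vv : ∀ {m x S} → IsVertexVisNumber G m → IsVisibilitySet G x S → ∣ S ∣ ≤ m
  visibilitySet≤vv {m} {x} {S} (_ , vv-max) vis = decidable-stable (∣ S ∣ ≤? m)
    (¬¬-map (λ (k , vx@(_ , vx-max)) → ≤-trans (vx-max S vis) (vv-max x k vx)) (¬¬-visNumber vis))

  module _ {x u : Fin n} (x-u : Adj G x u) (only-u : ∀ w → Adj G x w → w ≡ u) where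

    u≢x : u ≢ x
    u≢x refl = irrefl G x-u

    visibilitySet-∪-leaf : ∀ {S} → IsVisibilitySet G x S → u ∉ S → IsVisibilitySet G u (S ∪ ⁅ x ⁆)
    visibilitySet-∪-leaf {S} (x∉S , visible) u∉S =
      u∉S∪x , λ y y∈ → [ visible-through-u y , visible-leaf y ]′ (x∈p∪q⁻ S ⁅ x ⁆ y∈)
      where
      u∉S∪x : u ∉ S ∪ ⁅ x ⁆
      u∉S∪x u∈ = [ u∉S , u≢x ∘ x∈⁅y⁆⇒x≡y x ]′ (x∈p∪q⁻ S ⁅ x ⁆ u∈)

      visible-leaf : ∀ y → y ∈ ⁅ x ⁆ → VisibleFrom u (S ∪ ⁅ x ⁆) y
      visible-leaf y y∈ with x∈⁅y⁆⇒x≡y x y∈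
      ... | refl = edge-visible u∉S∪x (sym G x-u)

      visible-through-u : ∀ y → y ∈ S → VisibleFrom u (S ∪ ⁅ x ⁆) y
      visible-through-u y y∈S with visible y y∈S
      ... | [] , _ , _ = contradiction y∈S x∉S
      ... | _∷_ {z = z} e P , shortest , _ ∷ P-sees with only-u z e
      ...   | refl = P , shortest-tail {e = e} shortest ,
                     All.zipWith sees (P-sees , shortest-tail-avoids-source {e = e} shortest)
        where
        sees : ∀ {z} → (z ∈ S → z ≡ y) × z ≢ x → z ∈ S ∪ ⁅ x ⁆ → z ≡ y
        sees (seen-in-S , z≢x) z∈ =
          [ seen-in-S , (λ z∈⁅x⁆ → contradiction (x∈⁅y⁆⇒x≡y x z∈⁅x⁆) z≢x) ]′ (x∈p∪q⁻ S ⁅ x ⁆ z∈)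

    visibilitySet⊆⁅neighbour⁆ : ∀ {S} → IsVisibilitySet G x S → u ∈ S → S ⊆ ⁅ u ⁆
    visibilitySet⊆⁅neighbour⁆ (x∉S , visible) u∈S {y} y∈S with visible y y∈S
    ... | [] , _ , _ = contradiction y∈S x∉S
    ... | _∷_ {z = z} e P , _ , _ ∷ P-sees with only-u z e
    ...   | refl = subst (_∈ ⁅ u ⁆) (All-verts⇒source P P-sees u∈S) (x∈⁅x⁆ u)

    -- A walk from u to z ∉ {u, x} leaves u towards some vertex; if that vertex is x, it
    -- returns to u at once, and we continue with the rest of the walk.
    second-neighbour : ∀ {z} → Walk G u z → z ≢ u → z ≢ x → ∃ λ w → Adj G u w × w ≢ x
    second-neighbour [] z≢u _ = contradiction refl z≢u
    second-neighbour (_∷_ {z = v} e P) z≢u z≢x with v ≟ x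
    ... | no v≢x = v , e , v≢x
    ... | yes refl with P
    ...   | [] = contradiction refl z≢x
    ...   | _∷_ {z = v′} e′ P′ with only-u v′ e′
    ...     | refl = second-neighbour P′ z≢u z≢x

    larger-visibilitySet-at-neighbour : Connected G → 3 ≤ n → ∀ {S} → IsVisibilitySet G x S →
      ∃ λ T → IsVisibilitySet G u T × ∣ S ∣ < ∣ T ∣
    larger-visibilitySet-at-neighbour conn 3≤n {S} vis with u ∈? S
    ... | no u∉S = S ∪ ⁅ x ⁆ , visibilitySet-∪-leaf vis u∉S , ∣p∣<∣p∪⁅x⁆∣ (proj₁ vis)
    ... | yes u∈S with third-vertex 3≤n x u
    ...   | z , z≢x , z≢u with second-neighbour (conn u z) z≢u z≢x
    ...     | w , u-w , w≢x = ⁅ w ⁆ ∪ ⁅ x ⁆ , neighbours-visibilitySet adj , S<T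
      where
      open ≤-Reasoning
      adj : ∀ {y} → y ∈ ⁅ w ⁆ ∪ ⁅ x ⁆ → Adj G u y
      adj {y} y∈ with x∈p∪q⁻ ⁅ w ⁆ ⁅ x ⁆ y∈
      ... | inj₁ y∈⁅w⁆ rewrite x∈⁅y⁆⇒x≡y w y∈⁅w⁆ = u-w
      ... | inj₂ y∈⁅x⁆ rewrite x∈⁅y⁆⇒x≡y x y∈⁅x⁆ = sym G x-u

      S<T : ∣ S ∣ < ∣ ⁅ w ⁆ ∪ ⁅ x ⁆ ∣
      S<T = begin-strict
        ∣ S ∣             ≤⟨ p⊆q⇒∣p∣≤∣q∣ (visibilitySet⊆⁅neighbour⁆ vis u∈S) ⟩
        ∣ ⁅ u ⁆ ∣         ≡⟨ ∣⁅x⁆∣≡1 u ⟩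
        1                 ≡⟨ ∣⁅x⁆∣≡1 w ⟨
        ∣ ⁅ w ⁆ ∣         <⟨ ∣p∣<∣p∪⁅x⁆∣ (≢-sym w≢x ∘ x∈⁅y⁆⇒x≡y w) ⟩
        ∣ ⁅ w ⁆ ∪ ⁅ x ⁆ ∣ ∎

lemma1p1 : (n : ℕ) (G : Graph n) → Connected G → 3 ≤ n →
    (x : Fin n) → IsLeaf G x →
    (k m : ℕ) → IsVisNumber G x k → IsVertexVisNumber G m → k < m
lemma1p1 n G conn 3≤n x (u , x-u , only-u) k m ((S , S-vis , refl) , _) vv =
  let T , T-vis , S<T = larger-visibilitySet-at-neighbour G x-u only-u conn 3≤n S-vis
  in <-≤-trans S<T (visibilitySet≤vv G vv T-vis)
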